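{- Let $v$ be even, let $X$ be a set of $v$ points partitioned into two parts $X_1,X_2$ of size $n=v/2$, let $k\ge 4$ be even with $n\ge k$, and let $h=k/2$. Suppose that on $X_1$ there is a resolvable $(n,h,2)$ covering design with parallel classes $\mathcal{P}_1,\ldots,\mathcal{P}_p$ and on $X_2$ a resolvable $(n,h,2)$ covering design with parallel classes $\mathcal{R}_1,\ldots,\mathcal{R}_p$, where each parallel class consists of exactly $2$ blocks. For $i=1,2$ let $(X_i,\mathcal{B}_i)$ be an $(n,k,4)$ covering design. Define $$\mathcal{B}=\mathcal{B}_1\cup\mathcal{B}_2\cup\bigcup_{i=1}^p\mathcal{P}_i\mathcal{R}_i.$$ Then $(X,\mathcal{B})$ is a $(v,k,4,5)$ cover.
   Context: A $(v,k,t,m)$ cover is a pair $(X,\mathcal{B})$ with $|X|=v$ and $\mathcal{B}$ a collection of $k$-subsets of $X$ such that every $m$-subset of $X$ meets some block in at least $t$ points; a $(v,k,t)$ covering design is a $(v,k,t,t)$ cover (every $t$-subset lies in some block). A $(v,k,t)$ covering design is resolvable if its blocks can be partitioned into parallel classes, each of which is a partition of the point set. For collections $\mathcal{A},\mathcal{B}$, $\mathcal{A}\mathcal{B}=\{A\cup B: A\in\mathcal{A},B\in\mathcal{B}\}$. -}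

module Defs where

open import Data.Nat using (ℕ; _≤_; _+_)
open import Data.Fin using (Fin)
open import Data.Fin.Subset using (Subset; _∩_; ∣_∣; ⊥)
open import Data.Fin.Subset.Properties using (_∈?_)
open import Data.List using (List; length; filter; map; concat; concatMap; allFin)
  renaming (_++_ to _++ᴸ_)
open import Data.List.Relation.Unary.All using (All)
open import Data.List.Relation.Unary.Any using (Any)
open import Data.Vec using () renaming (_++_ to _++ⱽ_)
open import Data.Product using (_×_)
open import Relation.Binary.PropositionalEquality using (_≡_)

-- A collection of blocks on the point set Fin v (a multiset, as a list).
Blocks : ℕ → Set
Blocks v = List (Subset v)

IsCover : (v k t m : ℕ) → Blocks v → Set
IsCover v k t m 𝓑 =
  All (λ B → ∣ B ∣ ≡ k) 𝓑 ×
  ((S : Subset v) → ∣ S ∣ ≡ m → Any (λ B → t ≤ ∣ S ∩ B ∣) 𝓑)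

IsCoveringDesign : (v k t : ℕ) → Blocks v → Set
IsCoveringDesign v k t 𝓑 = IsCover v k t t 𝓑

IsParallelClass : {v : ℕ} → Blocks v → Set
IsParallelClass {v} P = (x : Fin v) → length (filter (x ∈?_) P) ≡ 1

classBlocks : {v p : ℕ} → (Fin p → Blocks v) → Blocks v
classBlocks {p = p} P = concat (map P (allFin p))

IsResolvableCoveringDesign : (v k t p : ℕ) → (Fin p → Blocks v) → Set
IsResolvableCoveringDesign v k t p P =
  IsCoveringDesign v k t (classBlocks P) × ((i : Fin p) → IsParallelClass (P i))

-- Points: X = Fin (n + n), X₁ = first n points, X₂ = last n points.
embed₁ : {n : ℕ} → Subset n → Subset (n + n)
embed₁ {n} A = A ++ⱽ ⊥

embed₂ : {n : ℕ} → Subset n → Subset (n + n)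
embed₂ {n} A = ⊥ ++ⱽ A

-- 𝓐𝓑 = { A ∪ B : A ∈ 𝓐, B ∈ 𝓑 } with 𝓐 on X₁ and 𝓑 on X₂
-- (for A ⊆ X₁, B ⊆ X₂ the union A ∪ B is the concatenation A ++ B).
productBlocks : {n : ℕ} → Blocks n → Blocks n → Blocks (n + n)
productBlocks 𝓐 𝓑 = concatMap (λ A → map (λ B → A ++ⱽ B) 𝓑) 𝓐

combinedBlocks : {n p : ℕ} → Blocks n → Blocks n →
  (Fin p → Blocks n) → (Fin p → Blocks n) → Blocks (n + n)
combinedBlocks {p = p} B₁ B₂ P R =
  map embed₁ B₁ ++ᴸ (map embed₂ B₂ ++ᴸ
    concat (map (λ i → productBlocks (P i) (R i)) (allFin p)))

module Submission where

-- Write a 5-subset S of X = X₁ ⊔ X₂ as S₁ ++ S₂ with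
-- |S₁| + |S₂| = 5.  Then one of four cases holds:
--   * |S₁| ≥ 4 (or |S₂| ≥ 4): S₁ contains a 4-subset, which lies in a block
--     of the (n,k,4) covering design 𝓑₁ (resp. 𝓑₂);
--   * |S₁| ≥ 3 and |S₂| ≥ 2 (or symmetrically): two points of S₂ lie in a
--     block of the resolvable (n,h,2) design on X₂, say in the class 𝓡ᵢ;
--     the matching class 𝓟ᵢ has only two blocks, so by pigeonhole one of
--     them contains two of the three points of S₁; the union of these two
--     blocks is a block of 𝓟ᵢ𝓡ᵢ meeting S in at least 4 points.

open import Defs
open import Data.Nat using (ℕ; zero; suc; _≤_; _+_; z≤n; s≤s)
open import Data.Nat.Properties
  using (≤-trans; +-mono-≤; m≤m+n; m≤n+m; +-suc; +-identityʳ; m≤n⇒m≤1+n)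
open import Data.Bool using (true; false)
open import Data.Fin using (Fin)
open import Data.Fin.Subset using (Subset; _∩_; _∪_; _⊆_; _∈_; ∣_∣; ⊥)
open import Data.Fin.Subset.Properties
  using (_∈?_; ∣⊥∣≡0; ⊆-min; p⊆q⇒∣p∣≤∣q∣; x∈p∩q⁺; x∈p∩q⁻; x∈p∪q⁺)
open import Data.Vec using (_∷_; []; splitAt; here; there) renaming (_++_ to _++ⱽ_)
open import Data.Vec.Properties using (zipWith-++)
open import Data.List using (length; map; concat; allFin; _∷_; [])
open import Data.List.Properties using (filter-none)
open import Data.List.Membership.Propositional.Properties using (∈-allFin)
open import Data.List.Relation.Unary.All as All using (All)
open import Data.List.Relation.Unary.All.Properties as AllP using (¬Any⇒All¬)
open import Data.List.Relation.Unary.Any as Any using (Any)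
import Data.List.Relation.Unary.Any.Properties as AnyP
open import Data.Product using (Σ; _×_; _,_; proj₁)
open import Data.Sum using (_⊎_; inj₁; inj₂)
open import Relation.Nullary using (yes; no)
open import Relation.Binary.PropositionalEquality
  using (_≡_; refl; sym; trans; cong; cong₂; subst)

∣++∣ : ∀ {m l} (A : Subset m) (B : Subset l) → ∣ A ++ⱽ B ∣ ≡ ∣ A ∣ + ∣ B ∣
∣++∣ []          B = refl
∣++∣ (true ∷ A)  B = cong suc (∣++∣ A B)
∣++∣ (false ∷ A) B = ∣++∣ A B

∣∩++∣ : ∀ {m l} (A C : Subset m) (B D : Subset l) →
  ∣ (A ++ⱽ B) ∩ (C ++ⱽ D) ∣ ≡ ∣ A ∩ C ∣ + ∣ B ∩ D ∣
∣∩++∣ A C B D =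
  trans (cong ∣_∣ (zipWith-++ _ A B C D)) (∣++∣ (A ∩ C) (B ∩ D))

∣∪∣≤∣∣+∣∣ : ∀ {m} (A B : Subset m) → ∣ A ∪ B ∣ ≤ ∣ A ∣ + ∣ B ∣
∣∪∣≤∣∣+∣∣ []          []          = z≤n
∣∪∣≤∣∣+∣∣ (true ∷ A)  (true ∷ B)  =
  s≤s (subst (∣ A ∪ B ∣ ≤_) (sym (+-suc ∣ A ∣ ∣ B ∣)) (m≤n⇒m≤1+n (∣∪∣≤∣∣+∣∣ A B)))
∣∪∣≤∣∣+∣∣ (true ∷ A)  (false ∷ B) = s≤s (∣∪∣≤∣∣+∣∣ A B)
∣∪∣≤∣∣+∣∣ (false ∷ A) (true ∷ B)  =
  subst (suc ∣ A ∪ B ∣ ≤_) (sym (+-suc ∣ A ∣ ∣ B ∣)) (s≤s (∣∪∣≤∣∣+∣∣ A B))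
∣∪∣≤∣∣+∣∣ (false ∷ A) (false ∷ B) = ∣∪∣≤∣∣+∣∣ A B

∩-monoˡ-⊆ : ∀ {m} {S T : Subset m} (B : Subset m) → S ⊆ T → S ∩ B ⊆ T ∩ B
∩-monoˡ-⊆ B S⊆T x∈S∩B with x∈p∩q⁻ _ B x∈S∩B
... | x∈S , x∈B = x∈p∩q⁺ (S⊆T x∈S , x∈B)

subsetOfSize : ∀ {m} c (T : Subset m) → c ≤ ∣ T ∣ →
  Σ (Subset m) (λ S → S ⊆ T × ∣ S ∣ ≡ c)
subsetOfSize {m} zero T _ = ⊥ , ⊆-min T , ∣⊥∣≡0 m
subsetOfSize (suc c) (false ∷ T) c<∣T∣ with subsetOfSize (suc c) T c<∣T∣
... | S , S⊆T , ∣S∣≡c = false ∷ S , (λ { (there x∈S) → there (S⊆T x∈S) }) , ∣S∣≡c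
subsetOfSize (suc c) (true ∷ T) (s≤s c≤∣T∣) with subsetOfSize c T c≤∣T∣
... | S , S⊆T , ∣S∣≡c =
  true ∷ S , (λ { here → here ; (there x∈S) → there (S⊆T x∈S) }) , cong suc ∣S∣≡c

∣∣≤∣∩∣+∣∩∣ : ∀ {m} (T A B : Subset m) → (∀ {x} → x ∈ T → x ∈ A ⊎ x ∈ B) →
  ∣ T ∣ ≤ ∣ T ∩ A ∣ + ∣ T ∩ B ∣
∣∣≤∣∩∣+∣∩∣ T A B covered =
  ≤-trans (p⊆q⇒∣p∣≤∣q∣ T⊆∪) (∣∪∣≤∣∣+∣∣ (T ∩ A) (T ∩ B))
  where
  T⊆∪ : T ⊆ (T ∩ A) ∪ (T ∩ B)
  T⊆∪ x∈T with covered x∈T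
  ... | inj₁ x∈A = x∈p∪q⁺ (inj₁ (x∈p∩q⁺ (x∈T , x∈A)))
  ... | inj₂ x∈B = x∈p∪q⁺ (inj₂ (x∈p∩q⁺ (x∈T , x∈B)))

Meets : ∀ {m} → ℕ → Blocks m → Subset m → Set
Meets t 𝓑 S = Any (λ B → t ≤ ∣ S ∩ B ∣) 𝓑

-- A (m,k,t) covering design meets every set of at least t points in t
-- points: apply the design to a t-subset.
covers-large : ∀ {m k t} (𝓑 : Blocks m) → IsCoveringDesign m k t 𝓑 →
  (T : Subset m) → t ≤ ∣ T ∣ → Meets t 𝓑 T
covers-large {t = t} 𝓑 (_ , covers) T t≤∣T∣ with subsetOfSize t T t≤∣T∣
... | S , S⊆T , ∣S∣≡t =
  Any.map (λ {B} t≤∣S∩B∣ → ≤-trans t≤∣S∩B∣ (p⊆q⇒∣p∣≤∣q∣ (∩-monoˡ-⊆ B S⊆T)))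
          (covers S ∣S∣≡t)

parallel-covers : ∀ {m} (L : Blocks m) → IsParallelClass L →
  (x : Fin m) → Any (x ∈_) L
parallel-covers L parallel x with Any.any? (x ∈?_) L
... | yes x∈L = x∈L
... | no  x∉L with trans (cong length (sym (filter-none (x ∈?_) (¬Any⇒All¬ L x∉L))))
                         (parallel x)
...   | ()

pigeonhole : ∀ a b → 3 ≤ a + b → 2 ≤ a ⊎ 2 ≤ b
pigeonhole (suc (suc a)) b _ = inj₁ (s≤s (s≤s z≤n))
pigeonhole 0 b 3≤b = inj₂ (≤-trans (s≤s (s≤s z≤n)) 3≤b)
pigeonhole 1 (suc b) (s≤s 2≤b) = inj₂ (≤-trans (s≤s (s≤s z≤n)) 2≤b)

two-block-class : ∀ {m} (L : Blocks m) → length L ≡ 2 → IsParallelClass L →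
  (T : Subset m) → 3 ≤ ∣ T ∣ → Meets 2 L T
two-block-class (A ∷ B ∷ []) refl parallel T 3≤∣T∣
  with pigeonhole ∣ T ∩ A ∣ ∣ T ∩ B ∣ (≤-trans 3≤∣T∣ (∣∣≤∣∩∣+∣∩∣ T A B in-A-or-B))
  where
  in-A-or-B : ∀ {x} → x ∈ T → x ∈ A ⊎ x ∈ B
  in-A-or-B {x} _ with parallel-covers (A ∷ B ∷ []) parallel x
  ... | Any.here x∈A            = inj₁ x∈A
  ... | Any.there (Any.here x∈B) = inj₂ x∈B
... | inj₁ 2≤∣T∩A∣ = Any.here 2≤∣T∩A∣
... | inj₂ 2≤∣T∩B∣ = Any.there (Any.here 2≤∣T∩B∣)

classBlocks-Any : ∀ {m p} (P : Fin p → Blocks m) {Q : Subset m → Set} →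
  Any Q (classBlocks P) → Any (λ i → Any Q (P i)) (allFin p)
classBlocks-Any {p = p} P q = AnyP.map⁻ (AnyP.concat⁻ (map P (allFin p)) q)

classBlocks-All : ∀ {m p} (P : Fin p → Blocks m) {Q : Subset m → Set} →
  All Q (classBlocks P) → (i : Fin p) → All Q (P i)
classBlocks-All P q i = All.lookup (AllP.map⁻ (AllP.concat⁻ q)) (∈-allFin i)

productBlocks-size : ∀ {n h} (𝓐 𝓑 : Blocks n) →
  All (λ A → ∣ A ∣ ≡ h) 𝓐 → All (λ B → ∣ B ∣ ≡ h) 𝓑 →
  All (λ C → ∣ C ∣ ≡ h + h) (productBlocks 𝓐 𝓑)
productBlocks-size 𝓐 𝓑 sizes𝓐 sizes𝓑 =
  AllP.concat⁺ (AllP.map⁺ (All.map (λ {A} ∣A∣≡h → AllP.map⁺ (All.map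
    (λ {B} ∣B∣≡h → trans (∣++∣ A B) (cong₂ _+_ ∣A∣≡h ∣B∣≡h)) sizes𝓑)) sizes𝓐))

productBlocks-meets : ∀ {n a b} (𝓐 𝓑 : Blocks n) (S₁ S₂ : Subset n) →
  Meets a 𝓐 S₁ → Meets b 𝓑 S₂ → Meets (a + b) (productBlocks 𝓐 𝓑) (S₁ ++ⱽ S₂)
productBlocks-meets 𝓐 𝓑 S₁ S₂ meets₁ meets₂ =
  AnyP.concatMap⁺ _ (Any.map (λ {A} a≤ → AnyP.map⁺ (Any.map (λ {B} b≤ →
    subst (_ ≤_) (sym (∣∩++∣ S₁ A S₂ B)) (+-mono-≤ a≤ b≤)) meets₂)) meets₁)

module Combined {n p : ℕ} (B₁ B₂ : Blocks n) (P R : Fin p → Blocks n) where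

  𝓑 : Blocks (n + n)
  𝓑 = combinedBlocks B₁ B₂ P R

  sizes : ∀ {h k} → k ≡ h + h →
    All (λ B → ∣ B ∣ ≡ k) B₁ → All (λ B → ∣ B ∣ ≡ k) B₂ →
    ((i : Fin p) → All (λ A → ∣ A ∣ ≡ h) (P i)) →
    ((i : Fin p) → All (λ A → ∣ A ∣ ≡ h) (R i)) →
    All (λ B → ∣ B ∣ ≡ k) 𝓑
  sizes {h} {k} k≡h+h sizes₁ sizes₂ sizesP sizesR =
    AllP.++⁺ (AllP.map⁺ {f = embed₁ {n}} (All.map (λ {B} → size-embed₁ B) sizes₁))
      (AllP.++⁺ (AllP.map⁺ {f = embed₂ {n}} (All.map (λ {B} → size-embed₂ B) sizes₂))
        (AllP.concat⁺ (AllP.map⁺ {xs = allFin p} (All.tabulate (λ {i} _ → subst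
          (λ c → All (λ C → ∣ C ∣ ≡ c) (productBlocks (P i) (R i))) (sym k≡h+h)
          (productBlocks-size (P i) (R i) (sizesP i) (sizesR i)))))))
    where
    size-embed₁ : ∀ B → ∣ B ∣ ≡ k → ∣ embed₁ B ∣ ≡ k
    size-embed₁ B ∣B∣≡k = trans (∣++∣ B (⊥ {n = n}))
      (trans (cong₂ _+_ ∣B∣≡k (∣⊥∣≡0 n)) (+-identityʳ k))
    size-embed₂ : ∀ B → ∣ B ∣ ≡ k → ∣ embed₂ B ∣ ≡ k
    size-embed₂ B ∣B∣≡k = trans (∣++∣ (⊥ {n = n}) B)
      (trans (cong (_+ ∣ B ∣) (∣⊥∣≡0 n)) ∣B∣≡k)

  meets-B₁ : ∀ {t} (S₁ S₂ : Subset n) → Meets t B₁ S₁ → Meets t 𝓑 (S₁ ++ⱽ S₂)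
  meets-B₁ S₁ S₂ meets = AnyP.++⁺ˡ (AnyP.map⁺ (Any.map (λ {B} t≤ →
    subst (_ ≤_) (sym (∣∩++∣ S₁ B S₂ ⊥)) (≤-trans t≤ (m≤m+n _ _))) meets))

  meets-B₂ : ∀ {t} (S₁ S₂ : Subset n) → Meets t B₂ S₂ → Meets t 𝓑 (S₁ ++ⱽ S₂)
  meets-B₂ S₁ S₂ meets = AnyP.++⁺ʳ (map embed₁ B₁) (AnyP.++⁺ˡ (AnyP.map⁺
    (Any.map (λ {B} t≤ →
      subst (_ ≤_) (sym (∣∩++∣ S₁ ⊥ S₂ B)) (≤-trans t≤ (m≤n+m _ _))) meets)))

  meets-product : ∀ {a b} (S₁ S₂ : Subset n) →
    Any (λ i → Meets a (P i) S₁ × Meets b (R i) S₂) (allFin p) →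
    Meets (a + b) 𝓑 (S₁ ++ⱽ S₂)
  meets-product S₁ S₂ witness =
    AnyP.++⁺ʳ (map embed₁ B₁) (AnyP.++⁺ʳ (map embed₂ B₂) (AnyP.concat⁺
      (AnyP.map⁺ (Any.map (λ {i} (meets₁ , meets₂) →
        productBlocks-meets (P i) (R i) S₁ S₂ meets₁ meets₂) witness))))

data FiveSplit : ℕ → ℕ → Set where
  left-four  : ∀ {a b} → 4 ≤ a → FiveSplit a b
  right-four : ∀ {a b} → 4 ≤ b → FiveSplit a b
  three-two  : ∀ {a b} → 3 ≤ a → 2 ≤ b → FiveSplit a b
  two-three  : ∀ {a b} → 2 ≤ a → 3 ≤ b → FiveSplit a b

five-split : ∀ a b → a + b ≡ 5 → FiveSplit a b
five-split 0 _ refl = right-four (s≤s (s≤s (s≤s (s≤s z≤n))))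
five-split 1 _ refl = right-four (s≤s (s≤s (s≤s (s≤s z≤n))))
five-split 2 _ refl = two-three (s≤s (s≤s z≤n)) (s≤s (s≤s (s≤s z≤n)))
five-split 3 _ refl = three-two (s≤s (s≤s (s≤s z≤n))) (s≤s (s≤s z≤n))
five-split (suc (suc (suc (suc a)))) _ _ = left-four (s≤s (s≤s (s≤s (s≤s z≤n))))

theorem18 : (n k h p : ℕ) → k ≡ h + h → 4 ≤ k → k ≤ n →
    (P R : Fin p → Blocks n) →
    IsResolvableCoveringDesign n h 2 p P →
    IsResolvableCoveringDesign n h 2 p R →
    ((i : Fin p) → length (P i) ≡ 2) →
    ((i : Fin p) → length (R i) ≡ 2) →
    (B₁ B₂ : Blocks n) →
    IsCoveringDesign n k 4 B₁ →
    IsCoveringDesign n k 4 B₂ →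
    IsCover (n + n) k 4 5 (combinedBlocks B₁ B₂ P R)
theorem18 n k h p k≡h+h _ _ P R (designP , parallelP) (designR , parallelR)
          twoP twoR B₁ B₂ design₁ design₂ =
  sizes k≡h+h (proj₁ design₁) (proj₁ design₂)
        (classBlocks-All P (proj₁ designP)) (classBlocks-All R (proj₁ designR)) ,
  covers
  where
  open Combined B₁ B₂ P R
  covers : (S : Subset (n + n)) → ∣ S ∣ ≡ 5 → Meets 4 𝓑 S
  covers S ∣S∣≡5 with splitAt n S
  ... | S₁ , S₂ , refl with five-split ∣ S₁ ∣ ∣ S₂ ∣ (trans (sym (∣++∣ S₁ S₂)) ∣S∣≡5)
  ... | left-four 4≤∣S₁∣  = meets-B₁ S₁ S₂ (covers-large B₁ design₁ S₁ 4≤∣S₁∣)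
  ... | right-four 4≤∣S₂∣ = meets-B₂ S₁ S₂ (covers-large B₂ design₂ S₂ 4≤∣S₂∣)
  ... | three-two 3≤∣S₁∣ 2≤∣S₂∣ = meets-product S₁ S₂ (Any.map
    (λ {i} meets₂ → two-block-class (P i) (twoP i) (parallelP i) S₁ 3≤∣S₁∣ , meets₂)
    (classBlocks-Any R (covers-large (classBlocks R) designR S₂ 2≤∣S₂∣)))
  ... | two-three 2≤∣S₁∣ 3≤∣S₂∣ = meets-product S₁ S₂ (Any.map
    (λ {i} meets₁ → meets₁ , two-block-class (R i) (twoR i) (parallelR i) S₂ 3≤∣S₂∣)
    (classBlocks-Any P (covers-large (classBlocks P) designP S₁ 2≤∣S₁∣)))
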